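{- Let $G$ be a $k$-$\gamma_c$-critical graph having at least one cut vertex, let $D$ be a $\gamma_c$-set of $G$, let $B$ be a block of $G$, let $x,y\in V(B)$ with $xy\notin E(G)$, and let $D_{xy}$ be a $\gamma_c$-set of $G+xy$. Then $|D_{xy}\cap V(B)| < |D\cap V(B)|$.
   Context: A connected dominating set of $G$ is a set $D$ such that every vertex is in $D$ or adjacent to a vertex of $D$ and $G[D]$ is connected; $\gamma_c(G)$ is its minimum size, and a minimum one is a $\gamma_c$-set. $G$ is $k$-$\gamma_c$-critical if $\gamma_c(G)=k$ and $\gamma_c(G+uv)<k$ for all non-adjacent $u,v$. -}

module Defs where

open import Data.Nat using (ℕ; _≤_; _<_)
open import Data.Bool using (Bool; true; false; _∨_; _∧_; T)
open import Data.Fin using (Fin)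
open import Data.Fin.Properties using (_≟_)
open import Data.Fin.Subset using (Subset; _∈_; _∉_; _⊆_; _-_; ∣_∣; ⊤)
open import Data.Product using (Σ; _×_; ∃; ∃-syntax; _,_)
open import Data.Sum using (_⊎_)
open import Relation.Nullary using (¬_)
open import Relation.Nullary.Decidable using (⌊_⌋)
open import Relation.Binary.PropositionalEquality using (_≡_; _≢_)

record Graph (n : ℕ) : Set where
  field
    adj   : Fin n → Fin n → Bool
    sym   : ∀ u v → adj u v ≡ adj v u
    irrefl : ∀ v → adj v v ≡ false
open Graph public

module _ {n : ℕ} where

  Adj : Graph n → Fin n → Fin n → Set
  Adj G u v = T (adj G u v)

  addAdj : Graph n → Fin n → Fin n → Fin n → Fin n → Bool
  addAdj G x y a b =
    adj G a b ∨ (⌊ a ≟ x ⌋ ∧ ⌊ b ≟ y ⌋) ∨ (⌊ a ≟ y ⌋ ∧ ⌊ b ≟ x ⌋)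

  addEdge : (G : Graph n) (x y : Fin n) → x ≢ y → Graph n
  addEdge G x y x≢y = record
    { adj = addAdj G x y
    ; sym = symP
    ; irrefl = irr
    }
    where
    open import Data.Bool.Properties using (∨-comm; ∨-assoc)
    open import Relation.Binary.PropositionalEquality using (refl; cong; cong₂; trans)
    open import Relation.Nullary using (yes; no)
    open import Data.Empty using (⊥-elim)
    open import Relation.Binary.PropositionalEquality using (sym)
    symP : ∀ a b → addAdj G x y a b ≡ addAdj G x y b a
    symP a b with a ≟ x | b ≟ y | a ≟ y | b ≟ x
    ... | p | q | r | s = trans (cong₂ _∨_ (Graph.sym G a b) (∨-comm (⌊ p ⌋ ∧ ⌊ q ⌋) (⌊ r ⌋ ∧ ⌊ s ⌋)))
                                (cong (adj G b a ∨_) (cong₂ _∨_ (∧c ⌊ r ⌋ ⌊ s ⌋) (∧c ⌊ p ⌋ ⌊ q ⌋)))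
      where
      open import Data.Bool.Properties using () renaming (∧-comm to ∧c)
    irr : ∀ v → addAdj G x y v v ≡ false
    irr v with v ≟ x | v ≟ y
    ... | yes refl | yes refl = ⊥-elim (x≢y refl)
    ... | yes _ | no _ rewrite Graph.irrefl G v = refl
    ... | no _ | yes _ rewrite Graph.irrefl G v = refl
    ... | no _ | no _ rewrite Graph.irrefl G v = refl

  -- Reach G S a b : there is a walk from a to b in G using only vertices of S
  -- (i.e. a and b are joined by a path in the induced subgraph G[S]).
  data Reach (G : Graph n) (S : Subset n) : Fin n → Fin n → Set where
    here : ∀ {a} → a ∈ S → Reach G S a a
    step : ∀ {a c b} → a ∈ S → Adj G a c → Reach G S c b → Reach G S a b

  ConnectedIn : Graph n → Subset n → Set
  ConnectedIn G S = ∀ a b → a ∈ S → b ∈ S → Reach G S a b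

  Dominating : Graph n → Subset n → Set
  Dominating G D = ∀ v → v ∈ D ⊎ (∃[ u ] (u ∈ D × Adj G u v))

  IsCDS : Graph n → Subset n → Set
  IsCDS G D = Dominating G D × ConnectedIn G D

  IsGammaCSet : Graph n → Subset n → Set
  IsGammaCSet G D = IsCDS G D × (∀ D' → IsCDS G D' → ∣ D ∣ ≤ ∣ D' ∣)

  GammaC≡ : Graph n → ℕ → Set
  GammaC≡ G k = Σ (Subset n) λ D → IsGammaCSet G D × ∣ D ∣ ≡ k

  GammaC< : Graph n → ℕ → Set
  GammaC< G k = Σ (Subset n) λ D → IsGammaCSet G D × ∣ D ∣ < k

  Critical : ℕ → Graph n → Set
  Critical k G = GammaC≡ G k ×
    (∀ u v → (u≢v : u ≢ v) → ¬ Adj G u v → GammaC< (addEdge G u v u≢v) k)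

  -- v is a cut vertex of the induced subgraph G[S]: removing v increases the
  -- number of components, i.e. some a, b ≠ v connected in G[S] become
  -- disconnected in G[S] - v.
  CutVertexIn : Graph n → Subset n → Fin n → Set
  CutVertexIn G S v = v ∈ S × ∃[ a ] ∃[ b ]
    (a ∈ S × b ∈ S × a ≢ v × b ≢ v × Reach G S a b × ¬ Reach G (S - v) a b)

  CutVertex : Graph n → Fin n → Set
  CutVertex G v = CutVertexIn G ⊤ v

  Nonseparable : Graph n → Subset n → Set
  Nonseparable G S = ConnectedIn G S × (∀ v → ¬ CutVertexIn G S v)

  -- B (as a vertex set) is a block of G: a maximal nonempty connected
  -- subgraph with no cut vertex (maximal such subgraphs are induced).
  IsBlock : Graph n → Subset n → Set
  IsBlock G B = (∃[ v ] v ∈ B) × Nonseparable G B ×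
    (∀ B' → B ⊆ B' → Nonseparable G B' → B' ⊆ B)

module Submission where

-- Let G be k-γc-critical, D a γc-set of G, B a block of G containing the
-- non-adjacent vertices x, y, and Dxy a γc-set of G + xy.  The proof shows that
--
--     D' = (Dxy ∖ B) ∪ (D ∩ B)
--
-- is a connected dominating set of G.  Then, since γc(G + xy) < k = γc(G),
--
--   ∣ Dxy ∖ B ∣ + ∣ Dxy ∩ B ∣ = ∣ Dxy ∣ < k ≤ ∣ D' ∣ ≤ ∣ Dxy ∖ B ∣ + ∣ D ∩ B ∣,
--
-- and cancelling gives the claim.

open import Defs hiding (sym)
open import Function using (_∘_)
open import Data.Nat using (ℕ; suc; _+_; _≤_; _<_; s≤s)
open import Data.Nat.Properties using (+-suc; +-cancelˡ-<; ≤-<-trans; m≤n⇒m≤1+n; ≤-refl; module ≤-Reasoning)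
open import Data.Fin using (Fin)
open import Data.Fin.Properties using (_≟_)
open import Data.Fin.Subset using (Subset; inside; outside; _∈_; _∉_; _⊆_; _∩_; _∪_; _─_; _-_; ∁; ∣_∣; ⊤; ⊥; ⁅_⁆)
open import Data.Fin.Subset.Properties using (_∈?_; ∈⊤; ∉⊥; x∈⁅x⁆; x∈⁅y⁆⇒x≡y; x∉⁅y⁆⇒x≢y; x∈p∩q⁺; x∈p∩q⁻; x∈p∪q⁺; x∈p∪q⁻; p─q⊆p; x∈p∧x≢y⇒x∈p-y; x∈∁p⇒x∉p; x∉p⇒x∈∁p)
open import Data.Vec using ([]; _∷_)
open import Data.Vec.Base using (here; there)
open import Data.List using (List; []; _∷_)
open import Data.List.Relation.Unary.Any using (here; there)
open import Data.List.Membership.Propositional using () renaming (_∈_ to _∈ₗ_; _∉_ to _∉ₗ_)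
open import Data.List.Relation.Binary.Subset.Propositional using () renaming (_⊆_ to _⊆ₗ_)
open import Data.Bool using (T; _∨_; _∧_)
open import Data.Bool.Properties using (∨-identityʳ)
open import Data.Product using (Σ; ∃-syntax; _×_; _,_; proj₁; proj₂)
open import Data.Sum using (_⊎_; inj₁; inj₂; [_,_]′)
open import Data.Unit using (tt) renaming (⊤ to Unit)
open import Data.Empty using (⊥-elim)
open import Relation.Nullary using (¬_; Dec; yes; no)
open import Relation.Nullary.Decidable using (⌊_⌋)
open import Relation.Binary.PropositionalEquality using (_≡_; _≢_; refl; sym; trans; cong; subst)

x∈p─q⇒x∉q : ∀ {m} {x : Fin m} (p q : Subset m) → x ∈ p ─ q → x ∉ q
x∈p─q⇒x∉q (inside ∷ p) (outside ∷ q) here ()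
x∈p─q⇒x∉q (_ ∷ p) (_ ∷ q) (there x∈p─q) (there x∈q) = x∈p─q⇒x∉q p q x∈p─q x∈q

x∈p-y⁻ : ∀ {m} {x y : Fin m} {p : Subset m} → x ∈ p - y → x ∈ p × x ≢ y
x∈p-y⁻ {y = y} {p} x∈p-y = p─q⊆p p ⁅ y ⁆ x∈p-y , x∉⁅y⁆⇒x≢y (x∈p─q⇒x∉q p ⁅ y ⁆ x∈p-y)

-⊆- : ∀ {m} {p q : Subset m} {y : Fin m} → p ⊆ q → p - y ⊆ q - y
-⊆- p⊆q x∈p-y = x∈p∧x≢y⇒x∈p-y (p⊆q (proj₁ (x∈p-y⁻ x∈p-y))) (proj₂ (x∈p-y⁻ x∈p-y))

x∉p⇒p⊆p-x : ∀ {m} {x : Fin m} {p : Subset m} → x ∉ p → p ⊆ p - x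
x∉p⇒p⊆p-x x∉p w∈p = x∈p∧x≢y⇒x∈p-y w∈p λ { refl → x∉p w∈p }

x∉p⇒p⊆⊤-x : ∀ {m} {x : Fin m} {p : Subset m} → x ∉ p → p ⊆ ⊤ - x
x∉p⇒p⊆⊤-x x∉p w∈p = -⊆- (λ _ → ∈⊤) (x∉p⇒p⊆p-x x∉p w∈p)

another : ∀ {m} {p : Subset m} {x y : Fin m} → x ∈ p → y ∈ p → x ≢ y → ∀ v → ∃[ t ] (t ∈ p × t ≢ v)
another {x = x} x∈p y∈p x≢y v with x ≟ v
... | yes refl = _ , y∈p , x≢y ∘ sym
... | no  x≢v  = x , x∈p , x≢v

∣p∣≡∣p∖q∣+∣p∩q∣ : ∀ {m} (p q : Subset m) → ∣ p ∣ ≡ ∣ p ∩ ∁ q ∣ + ∣ p ∩ q ∣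
∣p∣≡∣p∖q∣+∣p∩q∣ []            []            = refl
∣p∣≡∣p∖q∣+∣p∩q∣ (inside  ∷ p) (inside  ∷ q) =
  trans (cong suc (∣p∣≡∣p∖q∣+∣p∩q∣ p q)) (sym (+-suc ∣ p ∩ ∁ q ∣ ∣ p ∩ q ∣))
∣p∣≡∣p∖q∣+∣p∩q∣ (inside  ∷ p) (outside ∷ q) = cong suc (∣p∣≡∣p∖q∣+∣p∩q∣ p q)
∣p∣≡∣p∖q∣+∣p∩q∣ (outside ∷ p) (inside  ∷ q) = ∣p∣≡∣p∖q∣+∣p∩q∣ p q
∣p∣≡∣p∖q∣+∣p∩q∣ (outside ∷ p) (outside ∷ q) = ∣p∣≡∣p∖q∣+∣p∩q∣ p q

∣p∪q∣≤∣p∣+∣q∣ : ∀ {m} (p q : Subset m) → ∣ p ∪ q ∣ ≤ ∣ p ∣ + ∣ q ∣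
∣p∪q∣≤∣p∣+∣q∣ []            []            = ≤-refl
∣p∪q∣≤∣p∣+∣q∣ (inside  ∷ p) (inside  ∷ q) =
  s≤s (subst (∣ p ∪ q ∣ ≤_) (sym (+-suc ∣ p ∣ ∣ q ∣)) (m≤n⇒m≤1+n (∣p∪q∣≤∣p∣+∣q∣ p q)))
∣p∪q∣≤∣p∣+∣q∣ (inside  ∷ p) (outside ∷ q) = s≤s (∣p∪q∣≤∣p∣+∣q∣ p q)
∣p∪q∣≤∣p∣+∣q∣ (outside ∷ p) (inside  ∷ q) =
  subst (suc ∣ p ∪ q ∣ ≤_) (sym (+-suc ∣ p ∣ ∣ q ∣)) (s≤s (∣p∪q∣≤∣p∣+∣q∣ p q))
∣p∪q∣≤∣p∣+∣q∣ (outside ∷ p) (outside ∷ q) = ∣p∪q∣≤∣p∣+∣q∣ p q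

setOf : ∀ {m} → List (Fin m) → Subset m
setOf []       = ⊥
setOf (x ∷ xs) = ⁅ x ⁆ ∪ setOf xs

∈setOf⁺ : ∀ {m} {w : Fin m} {xs} → w ∈ₗ xs → w ∈ setOf xs
∈setOf⁺ {w = w} (here refl) = x∈p∪q⁺ (inj₁ (x∈⁅x⁆ w))
∈setOf⁺ (there w∈xs)        = x∈p∪q⁺ (inj₂ (∈setOf⁺ w∈xs))

∈setOf⁻ : ∀ {m} {w : Fin m} xs → w ∈ setOf xs → w ∈ₗ xs
∈setOf⁻ []       w∈ = ⊥-elim (∉⊥ w∈)
∈setOf⁻ (x ∷ xs) w∈ with x∈p∪q⁻ ⁅ x ⁆ (setOf xs) w∈
... | inj₁ w∈⁅x⁆  = here (x∈⁅y⁆⇒x≡y x w∈⁅x⁆)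
... | inj₂ w∈rest = there (∈setOf⁻ xs w∈rest)

adj-sym : ∀ {n} (G : Graph n) {u v : Fin n} → Adj G u v → Adj G v u
adj-sym G {u} {v} = subst T (Graph.sym G u v)

transport : ∀ {n} {G H : Graph n} {S : Subset n} {a b : Fin n} →
  (∀ {u w} → u ∈ S → Adj H u w → Adj G u w) → Reach H S a b → Reach G S a b
transport H⇒G (here a∈S)     = here a∈S
transport H⇒G (step a∈S e r) = step a∈S (H⇒G a∈S e) (transport H⇒G r)

module Walks {n : ℕ} (G : Graph n) where
  open import Data.List.Membership.DecPropositional (_≟_ {n}) using () renaming (_∈?_ to _∈ₗ?_) public

  start∈ : ∀ {S a b} → Reach G S a b → a ∈ S
  start∈ (here a∈S)     = a∈S
  start∈ (step a∈S _ _) = a∈S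

  end∈ : ∀ {S a b} → Reach G S a b → b ∈ S
  end∈ (here b∈S)   = b∈S
  end∈ (step _ _ r) = end∈ r

  infixr 5 _++ʷ_
  _++ʷ_ : ∀ {S a b c} → Reach G S a b → Reach G S b c → Reach G S a c
  here _       ++ʷ r' = r'
  step a∈S e r ++ʷ r' = step a∈S e (r ++ʷ r')

  snoc : ∀ {S a b c} → Reach G S a b → Adj G b c → c ∈ S → Reach G S a c
  snoc r e c∈S = r ++ʷ step (end∈ r) e (here c∈S)

  reverse : ∀ {S a b} → Reach G S a b → Reach G S b a
  reverse (here a∈S)     = here a∈S
  reverse (step a∈S e r) = snoc (reverse r) (adj-sym G e) a∈S

  vertices : ∀ {S a b} → Reach G S a b → List (Fin n)
  vertices (here {a} _)     = a ∷ []
  vertices (step {a} _ _ r) = a ∷ vertices r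

  start∈vertices : ∀ {S a b} (r : Reach G S a b) → a ∈ₗ vertices r
  start∈vertices (here _)     = here refl
  start∈vertices (step _ _ _) = here refl

  vertex∈ : ∀ {S a b w} (r : Reach G S a b) → w ∈ₗ vertices r → w ∈ S
  vertex∈ (here a∈S)     (here refl)  = a∈S
  vertex∈ (step a∈S _ _) (here refl)  = a∈S
  vertex∈ (step _ _ r)   (there w∈r)  = vertex∈ r w∈r

  restrict : ∀ {S S' a b} (r : Reach G S a b) → (∀ {w} → w ∈ₗ vertices r → w ∈ S') → Reach G S' a b
  restrict (here _)     into = here (into (here refl))
  restrict (step _ e r) into = step (into (here refl)) e (restrict r (into ∘ there))

  weaken : ∀ {S S' a b} → S ⊆ S' → Reach G S a b → Reach G S' a b
  weaken S⊆S' r = restrict r (S⊆S' ∘ vertex∈ r)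

  Simple : ∀ {S a b} → Reach G S a b → Set
  Simple (here _)         = Unit
  Simple (step {a} _ _ r) = a ∉ₗ vertices r × Simple r

  prefix : ∀ {S a b s} (r : Reach G S a b) → s ∈ₗ vertices r → Reach G S a s
  prefix (here a∈S)     (here refl)  = here a∈S
  prefix (step a∈S _ _) (here refl)  = here a∈S
  prefix (step a∈S e r) (there s∈r)  = step a∈S e (prefix r s∈r)

  suffix : ∀ {S a b s} (r : Reach G S a b) → s ∈ₗ vertices r → Reach G S s b
  suffix (here a∈S)     (here refl) = here a∈S
  suffix (step a∈S e r) (here refl) = step a∈S e r
  suffix (step _ _ r)   (there s∈r) = suffix r s∈r

  prefix⊆ : ∀ {S a b s} (r : Reach G S a b) (s∈r : s ∈ₗ vertices r) → vertices (prefix r s∈r) ⊆ₗ vertices r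
  prefix⊆ (here _)     (here refl) w∈         = w∈
  prefix⊆ (step _ _ _) (here refl) (here refl) = here refl
  prefix⊆ (step _ _ r) (there s∈r) (here refl) = here refl
  prefix⊆ (step _ _ r) (there s∈r) (there w∈) = there (prefix⊆ r s∈r w∈)

  suffix⊆ : ∀ {S a b s} (r : Reach G S a b) (s∈r : s ∈ₗ vertices r) → vertices (suffix r s∈r) ⊆ₗ vertices r
  suffix⊆ (here _)     (here refl) w∈ = w∈
  suffix⊆ (step _ _ _) (here refl) w∈ = w∈
  suffix⊆ (step _ _ r) (there s∈r) w∈ = there (suffix⊆ r s∈r w∈)

  suffix-simple : ∀ {S a b s} (r : Reach G S a b) (s∈r : s ∈ₗ vertices r) → Simple r → Simple (suffix r s∈r)
  suffix-simple (here _)     (here refl) σ       = σ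
  suffix-simple (step _ _ _) (here refl) σ       = σ
  suffix-simple (step _ _ r) (there s∈r) (_ , σ) = suffix-simple r s∈r σ

  shortcut : ∀ {S a b} → Reach G S a b → Σ (Reach G S a b) Simple
  shortcut (here a∈S) = here a∈S , tt
  shortcut (step {a} a∈S e r) with shortcut r
  ... | r' , σ with a ∈ₗ? vertices r'
  ...   | yes a∈r' = suffix r' a∈r' , suffix-simple r' a∈r' σ
  ...   | no  a∉r' = step a∈S e r' , a∉r' , σ

  avoid : ∀ {S a b s v} (r : Reach G S a b) (s∈r : s ∈ₗ vertices r) → Simple r → v ≢ s →
    v ∉ₗ vertices (prefix r s∈r) ⊎ v ∉ₗ vertices (suffix r s∈r)
  avoid (here _)     (here refl) _ v≢s = inj₁ λ { (here v≡s) → v≢s v≡s ; (there ()) }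
  avoid (step _ _ _) (here refl) _ v≢s = inj₁ λ { (here v≡s) → v≢s v≡s ; (there ()) }
  avoid {v = v} (step {a} _ _ r) (there s∈r) (a∉r , σ) v≢s with v ≟ a
  ... | yes refl = inj₂ (a∉r ∘ suffix⊆ r s∈r)
  ... | no  v≢a  = [ (λ v∉p → inj₁ λ { (here v≡a) → v≢a v≡a ; (there v∈p) → v∉p v∈p }) , inj₂ ]′
                     (avoid r s∈r σ v≢s)

  first-entry : ∀ {S u t} (B : Subset n) → Reach G S u t → u ∉ B → t ∈ B →
    ∃[ r ] ∃[ c ] (r ∈ B × r ∈ S × Reach G (S ∩ ∁ B) u c × Adj G c r)
  first-entry B (here _) u∉B u∈B = ⊥-elim (u∉B u∈B)
  first-entry {u = u} B (step {c = c} u∈S e r) u∉B t∈B with c ∈? B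
  ... | yes c∈B = c , u , c∈B , start∈ r , here (x∈p∩q⁺ (u∈S , x∉p⇒x∈∁p u∉B)) , e
  ... | no  c∉B with first-entry B r c∉B t∈B
  ...   | r' , c' , r'∈B , r'∈S , w , e' = r' , c' , r'∈B , r'∈S , step (x∈p∩q⁺ (u∈S , x∉p⇒x∈∁p u∉B)) e w , e'

module Separation {n : ℕ} (G : Graph n) where
  open Walks G

  reach-dominating : ∀ {c D} → Dominating G D → c ∉ D → ∀ z → z ≢ c →
    ∃[ d ] (d ∈ D × Reach G (⊤ - c) z d)
  reach-dominating dom c∉D z z≢c with dom z
  ... | inj₁ z∈D           = z , z∈D , here (x∉p⇒p⊆⊤-x c∉D z∈D)
  ... | inj₂ (d , d∈D , e) =
    d , d∈D , step (x∈p∧x≢y⇒x∈p-y ∈⊤ z≢c) (adj-sym G e) (here (x∉p⇒p⊆⊤-x c∉D d∈D))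

  CDS-avoiding : ∀ {c D} → IsCDS G D → c ∉ D → ∀ a b → a ≢ c → b ≢ c → Reach G (⊤ - c) a b
  CDS-avoiding (dom , conn) c∉D a b a≢c b≢c
    with reach-dominating dom c∉D a a≢c | reach-dominating dom c∉D b b≢c
  ... | d₁ , d₁∈D , a→d₁ | d₂ , d₂∈D , b→d₂ =
    a→d₁ ++ʷ weaken (x∉p⇒p⊆⊤-x c∉D) (conn d₁ d₂ d₁∈D d₂∈D) ++ʷ reverse b→d₂

  cut-vertex∈CDS : ∀ {c D} → CutVertex G c → IsCDS G D → c ∈ D
  cut-vertex∈CDS {c} {D} (_ , a , b , _ , _ , a≢c , b≢c , _ , a↛b) cds with c ∈? D
  ... | yes c∈D = c∈D
  ... | no  c∉D = ⊥-elim (a↛b (CDS-avoiding cds c∉D a b a≢c b≢c))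

  nonseparable-avoid : ∀ {S v t₁ t₂} → Nonseparable G S → t₁ ∈ S → t₂ ∈ S → t₁ ≢ v → t₂ ≢ v →
    ¬ ¬ Reach G (S - v) t₁ t₂
  nonseparable-avoid {S} {v} {t₁} {t₂} (conn , no-cut) t₁∈S t₂∈S t₁≢v t₂≢v t₁↛t₂ with v ∈? S
  ... | yes v∈S = no-cut v (v∈S , t₁ , t₂ , t₁∈S , t₂∈S , t₁≢v , t₂≢v , conn t₁ t₂ t₁∈S t₂∈S , t₁↛t₂)
  ... | no  v∉S = t₁↛t₂ (weaken (x∉p⇒p⊆p-x v∉S) (conn t₁ t₂ t₁∈S t₂∈S))

  nonseparable-extend : ∀ {S S'} → S ⊆ S' → Nonseparable G S →
    (∀ v {s} → s ∈ S' → s ≢ v → ∃[ t ] (t ∈ S × t ≢ v × Reach G (S' - v) s t)) →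
    Nonseparable G S'
  nonseparable-extend {S} {S'} S⊆S' (conn , no-cut) escape = conn' , no-cut'
    where
    S'-v⊆S' : ∀ {v} → S' - v ⊆ S'
    S'-v⊆S' = proj₁ ∘ x∈p-y⁻

    -- s escapes into S avoiding t and t avoiding s; join the two ends inside S
    conn' : ConnectedIn G S'
    conn' s t s∈S' t∈S' with s ≟ t
    ... | yes refl = here s∈S'
    ... | no  s≢t with escape t s∈S' s≢t | escape s t∈S' (s≢t ∘ sym)
    ...   | t₁ , t₁∈S , _ , s→t₁ | t₂ , t₂∈S , _ , t→t₂ =
      weaken S'-v⊆S' s→t₁ ++ʷ weaken S⊆S' (conn t₁ t₂ t₁∈S t₂∈S) ++ʷ reverse (weaken S'-v⊆S' t→t₂)

    no-cut' : ∀ v → ¬ CutVertexIn G S' v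
    no-cut' v (_ , s , t , s∈S' , t∈S' , s≢v , t≢v , _ , s↛t)
      with escape v s∈S' s≢v | escape v t∈S' t≢v
    ... | t₁ , t₁∈S , t₁≢v , s→t₁ | t₂ , t₂∈S , t₂≢v , t→t₂ =
      nonseparable-avoid (conn , no-cut) t₁∈S t₂∈S t₁≢v t₂≢v
        λ t₁→t₂ → s↛t (s→t₁ ++ʷ weaken (-⊆- S⊆S') t₁→t₂ ++ʷ reverse t→t₂)

module Block {n : ℕ} {G : Graph n} {B : Subset n} (block : IsBlock G B) where
  open Walks G
  open Separation G

  nonseparable : Nonseparable G B
  nonseparable = proj₁ (proj₂ block)

  maximal : ∀ B' → B ⊆ B' → Nonseparable G B' → B' ⊆ B
  maximal = proj₂ (proj₂ block)

  -- For a simple walk q outside B from a neighbour of a ∈ B to a neighbour of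
  -- b ∈ B with a ≠ b, the set B ∪ V(q) is again nonseparable: every vertex of
  -- q can leave along q towards a or towards b while avoiding any other vertex.
  module Excursion {a b c₀ c₁ : Fin n} (a∈B : a ∈ B) (b∈B : b ∈ B) (a≢b : a ≢ b)
    (e₀ : Adj G a c₀) (q : Reach G (∁ B) c₀ c₁) (simple : Simple q) (e₁ : Adj G c₁ b) where

    L : List (Fin n)
    L = vertices q

    B' : Subset n
    B' = B ∪ setOf L

    B⊆B' : B ⊆ B'
    B⊆B' = x∈p∪q⁺ ∘ inj₁

    c₀∈B' : c₀ ∈ B'
    c₀∈B' = x∈p∪q⁺ (inj₂ (∈setOf⁺ (start∈vertices q)))

    L∉B : ∀ {v} → v ∈ₗ L → v ∉ B
    L∉B v∈L = x∈∁p⇒x∉p (vertex∈ q v∈L)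

    missing : ∀ {v ws} → ws ⊆ₗ L → v ∉ₗ ws → ∀ {w} → w ∈ₗ ws → w ∈ B' - v
    missing ws⊆L v∉ws w∈ws =
      x∈p∧x≢y⇒x∈p-y (x∈p∪q⁺ (inj₂ (∈setOf⁺ (ws⊆L w∈ws)))) λ { refl → v∉ws w∈ws }

    back-to-a : ∀ {v s} (s∈q : s ∈ₗ L) → v ∉ₗ vertices (prefix q s∈q) → a ≢ v → Reach G (B' - v) s a
    back-to-a s∈q v∉p a≢v =
      snoc (reverse (restrict (prefix q s∈q) (missing (prefix⊆ q s∈q) v∉p)))
           (adj-sym G e₀) (x∈p∧x≢y⇒x∈p-y (B⊆B' a∈B) a≢v)

    on-to-b : ∀ {v s} (s∈q : s ∈ₗ L) → v ∉ₗ vertices (suffix q s∈q) → b ≢ v → Reach G (B' - v) s b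
    on-to-b s∈q v∉p b≢v =
      snoc (restrict (suffix q s∈q) (missing (suffix⊆ q s∈q) v∉p)) e₁ (x∈p∧x≢y⇒x∈p-y (B⊆B' b∈B) b≢v)

    -- a vertex of q escapes to a or to b avoiding v: if v is on q, simplicity
    -- leaves one side of s free of v; otherwise both sides are, and a or b differs from v
    escape-q : ∀ v {s} → s ∈ₗ L → s ≢ v → ∃[ t ] (t ∈ B × t ≢ v × Reach G (B' - v) s t)
    escape-q v s∈q s≢v with v ∈ₗ? L
    ... | yes v∈q = [ (λ v∉p → a , a∈B , a≢v , back-to-a s∈q v∉p a≢v)
                    , (λ v∉p → b , b∈B , b≢v , on-to-b s∈q v∉p b≢v) ]′
                    (avoid q s∈q simple (s≢v ∘ sym))
      where
      a≢v : a ≢ v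
      a≢v refl = L∉B v∈q a∈B
      b≢v : b ≢ v
      b≢v refl = L∉B v∈q b∈B
    ... | no  v∉q = off-q (a ≟ v)
      where
      off-q : Dec (a ≡ v) → ∃[ t ] (t ∈ B × t ≢ v × Reach G (B' - v) _ t)
      off-q (no  a≢v)  = a , a∈B , a≢v , back-to-a s∈q (v∉q ∘ prefix⊆ q s∈q) a≢v
      off-q (yes refl) = b , b∈B , a≢b ∘ sym , on-to-b s∈q (v∉q ∘ suffix⊆ q s∈q) (a≢b ∘ sym)

    escape : ∀ v {s} → s ∈ B' → s ≢ v → ∃[ t ] (t ∈ B × t ≢ v × Reach G (B' - v) s t)
    escape v {s} s∈B' s≢v with x∈p∪q⁻ B (setOf L) s∈B'
    ... | inj₁ s∈B  = s , s∈B , s≢v , here (x∈p∧x≢y⇒x∈p-y s∈B' s≢v)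
    ... | inj₂ s∈L' = escape-q v (∈setOf⁻ L s∈L') s≢v

    B'-nonseparable : Nonseparable G B'
    B'-nonseparable = nonseparable-extend B⊆B' nonseparable escape

  -- Leaving B from a and coming back at b forces a = b: otherwise B together
  -- with the shortcut excursion would be a larger nonseparable set.
  excursion-returns : ∀ {a b c₀ c₁} → a ∈ B → b ∈ B →
    Adj G a c₀ → Reach G (∁ B) c₀ c₁ → Adj G c₁ b → a ≡ b
  excursion-returns {a} {b} a∈B b∈B e₀ walk e₁ with a ≟ b
  ... | yes a≡b = a≡b
  ... | no  a≢b =
    ⊥-elim (x∈∁p⇒x∉p (start∈ (proj₁ (shortcut walk))) (maximal B' B⊆B' B'-nonseparable c₀∈B'))
    where
    open Excursion a∈B b∈B a≢b e₀ (proj₁ (shortcut walk)) (proj₂ (shortcut walk)) e₁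

  attachment-is-cut : ∀ {x y u v} → x ∈ B → y ∈ B → x ≢ y → v ∈ B → u ∉ B → Adj G u v → CutVertex G v
  attachment-is-cut {u = u} {v} x∈B y∈B x≢y v∈B u∉B e with another x∈B y∈B x≢y v
  ... | t , t∈B , t≢v =
    ∈⊤ , u , t , ∈⊤ , ∈⊤ , (λ { refl → u∉B v∈B }) , t≢v ,
    step ∈⊤ e (weaken (λ _ → ∈⊤) (proj₁ nonseparable v t v∈B t∈B)) , u↛t
    where
    -- a walk from u to t avoiding v would be an excursion from v returning elsewhere
    u↛t : ¬ Reach G (⊤ - v) u t
    u↛t walk with first-entry B walk u∉B t∈B
    ... | r , c , r∈B , r∈⊤-v , u→c , e' =
      proj₂ (x∈p-y⁻ r∈⊤-v) (sym (excursion-returns v∈B r∈B (adj-sym G e) (weaken leaves-B u→c) e'))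
      where
      leaves-B : (⊤ - v) ∩ ∁ B ⊆ ∁ B
      leaves-B = proj₂ ∘ x∈p∩q⁻ (⊤ - v) (∁ B)

  stay-in-block : ∀ {S a b} → a ∈ B → b ∈ B → Reach G S a b → Reach G (S ∩ B) a b
  stay-in-block a∈B b∈B r = go r b∈B a∈B (start∈ r) (inj₁ refl)
    where
    Excursion : Fin n → Fin n → Set
    Excursion a c = ∃[ c₀ ] (Adj G a c₀ × Reach G (∁ B) c₀ c)

    -- invariant: the remaining walk starts at c, which is a or the end of an excursion from a
    go : ∀ {S a b c} → Reach G S c b → b ∈ B → a ∈ B → a ∈ S →
      c ≡ a ⊎ (c ∉ B × Excursion a c) → Reach G (S ∩ B) a b
    go (here _) _ a∈B a∈S (inj₁ refl) = here (x∈p∩q⁺ (a∈S , a∈B))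
    go (here _) b∈B _ _ (inj₂ (c∉B , _)) = ⊥-elim (c∉B b∈B)
    go (step {c = c'} _ e r) b∈B a∈B a∈S position with c' ∈? B | position
    ... | yes c'∈B | inj₁ refl =
      step (x∈p∩q⁺ (a∈S , a∈B)) e (go r b∈B c'∈B (start∈ r) (inj₁ refl))
    ... | yes c'∈B | inj₂ (_ , c₀ , e₀ , out) =
      go r b∈B a∈B a∈S (inj₁ (sym (excursion-returns a∈B c'∈B e₀ out e)))
    ... | no c'∉B | inj₁ refl =
      go r b∈B a∈B a∈S (inj₂ (c'∉B , c' , e , here (x∉p⇒x∈∁p c'∉B)))
    ... | no c'∉B | inj₂ (_ , c₀ , e₀ , out) =
      go r b∈B a∈B a∈S (inj₂ (c'∉B , c₀ , e₀ , snoc out e (x∉p⇒x∈∁p c'∉B)))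

addEdge-adj : ∀ {n} (G : Graph n) {x y : Fin n} (x≢y : x ≢ y) {u w : Fin n} →
  u ≢ x → u ≢ y → Adj (addEdge G x y x≢y) u w → Adj G u w
addEdge-adj G {x} {y} _ {u} {w} u≢x u≢y = old-edge (u ≟ x) (u ≟ y)
  where
  old-edge : (u≟x : Dec (u ≡ x)) (u≟y : Dec (u ≡ y)) →
    T (adj G u w ∨ (⌊ u≟x ⌋ ∧ ⌊ w ≟ y ⌋) ∨ (⌊ u≟y ⌋ ∧ ⌊ w ≟ x ⌋)) → T (adj G u w)
  old-edge (yes u≡x) _         = ⊥-elim (u≢x u≡x)
  old-edge (no _)    (yes u≡y) = ⊥-elim (u≢y u≡y)
  old-edge (no _)    (no _)    = subst T (∨-identityʳ (adj G u w))

module Exchange {n : ℕ} {G : Graph n} {B : Subset n} (block : IsBlock G B)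
  {x y : Fin n} (x∈B : x ∈ B) (y∈B : y ∈ B) (x≢y : x ≢ y)
  {D Dxy : Subset n} (D-cds : IsCDS G D) (Dxy-cds : IsCDS (addEdge G x y x≢y) Dxy) where

  open Walks G
  open Block block
  open Separation G using (cut-vertex∈CDS)

  H : Graph n
  H = addEdge G x y x≢y

  D' : Subset n
  D' = (Dxy ∩ ∁ B) ∪ (D ∩ B)

  kept-outside : ∀ {w} → w ∈ Dxy → w ∉ B → w ∈ D'
  kept-outside w∈Dxy w∉B = x∈p∪q⁺ (inj₁ (x∈p∩q⁺ (w∈Dxy , x∉p⇒x∈∁p w∉B)))

  kept-inside : ∀ {w} → w ∈ D → w ∈ B → w ∈ D'
  kept-inside w∈D w∈B = x∈p∪q⁺ (inj₂ (x∈p∩q⁺ (w∈D , w∈B)))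

  edge-from-outside : ∀ {u w} → u ∉ B → Adj H u w → Adj G u w
  edge-from-outside u∉B = addEdge-adj G x≢y (λ { refl → u∉B x∈B }) (λ { refl → u∉B y∈B })

  edge-to-outside : ∀ {u w} → w ∉ B → Adj H u w → Adj G u w
  edge-to-outside w∉B = adj-sym G ∘ edge-from-outside w∉B ∘ adj-sym H

  -- A vertex of B adjacent to a vertex outside B is a cut vertex, hence in D.
  attachment∈D : ∀ {u v} → v ∈ B → u ∉ B → Adj G u v → v ∈ D
  attachment∈D v∈B u∉B e = cut-vertex∈CDS (attachment-is-cut x∈B y∈B x≢y v∈B u∉B e) D-cds

  -- A vertex of B is dominated by D, a vertex outside B by Dxy through an edge
  -- of G; a dominator on the other side of B makes an attachment, which lies in D ∩ B.
  dominating : Dominating G D'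
  dominating v with v ∈? B
  ... | yes v∈B with proj₁ D-cds v
  ...   | inj₁ v∈D = inj₁ (kept-inside v∈D v∈B)
  ...   | inj₂ (u , u∈D , e) with u ∈? B
  ...     | yes u∈B = inj₂ (u , kept-inside u∈D u∈B , e)
  ...     | no  u∉B = inj₁ (kept-inside (attachment∈D v∈B u∉B e) v∈B)
  dominating v | no v∉B with proj₁ Dxy-cds v
  ...   | inj₁ v∈Dxy = inj₁ (kept-outside v∈Dxy v∉B)
  ...   | inj₂ (u , u∈Dxy , e) with u ∈? B
  ...     | yes u∈B = inj₂ (u , kept-inside (attachment∈D u∈B v∉B (adj-sym G (edge-to-outside v∉B e))) u∈B
                            , edge-to-outside v∉B e)
  ...     | no  u∉B = inj₂ (u , kept-outside u∈Dxy u∉B , edge-to-outside v∉B e)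

  to-x : ∀ {p} → p ∈ Dxy → Reach H (Dxy ∪ ⁅ x ⁆) p x
  to-x {p} p∈Dxy with proj₁ Dxy-cds x
  ... | inj₁ x∈Dxy = Walks.weaken H (x∈p∪q⁺ ∘ inj₁) (proj₂ Dxy-cds p x p∈Dxy x∈Dxy)
  ... | inj₂ (u , u∈Dxy , e) =
    Walks.snoc H (Walks.weaken H (x∈p∪q⁺ ∘ inj₁) (proj₂ Dxy-cds p u p∈Dxy u∈Dxy)) e
      (x∈p∪q⁺ (inj₂ (x∈⁅x⁆ x)))

  -- Every vertex of D' reaches D ∩ B inside D': a vertex of Dxy outside B walks
  -- towards x in G + xy; until it first enters B it uses edges of G, and the
  -- vertex where it enters B is an attachment, hence in D.
  to-core : ∀ {p} → p ∈ D' → ∃[ r ] (r ∈ D × r ∈ B × Reach G D' p r)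
  to-core {p} p∈D' with x∈p∪q⁻ (Dxy ∩ ∁ B) (D ∩ B) p∈D'
  ... | inj₂ p∈D∩B = p , proj₁ (x∈p∩q⁻ D B p∈D∩B) , proj₂ (x∈p∩q⁻ D B p∈D∩B) , here p∈D'
  ... | inj₁ p∈Dxy∖B with x∈p∩q⁻ Dxy (∁ B) p∈Dxy∖B
  ...   | p∈Dxy , p∈∁B with Walks.first-entry H B (to-x p∈Dxy) (x∈∁p⇒x∉p p∈∁B) x∈B
  ...     | r , c , r∈B , _ , p→c , e =
    r , r∈D , r∈B ,
    snoc (weaken in-D' (transport {H = H} in-G p→c)) (edge-from-outside c∉B e) (kept-inside r∈D r∈B)
    where
    off-B : ∀ {w} → w ∈ (Dxy ∪ ⁅ x ⁆) ∩ ∁ B → w ∉ B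
    off-B = x∈∁p⇒x∉p ∘ proj₂ ∘ x∈p∩q⁻ (Dxy ∪ ⁅ x ⁆) (∁ B)

    in-G : ∀ {u w} → u ∈ (Dxy ∪ ⁅ x ⁆) ∩ ∁ B → Adj H u w → Adj G u w
    in-G = edge-from-outside ∘ off-B

    -- x itself lies in B, so the walk before entering B stays in Dxy ∖ B
    in-D' : (Dxy ∪ ⁅ x ⁆) ∩ ∁ B ⊆ D'
    in-D' {w} w∈ with x∈p∪q⁻ Dxy ⁅ x ⁆ (proj₁ (x∈p∩q⁻ (Dxy ∪ ⁅ x ⁆) (∁ B) w∈))
    ... | inj₁ w∈Dxy = kept-outside w∈Dxy (off-B w∈)
    ... | inj₂ w∈⁅x⁆ = ⊥-elim (off-B w∈ (subst (_∈ B) (sym (x∈⁅y⁆⇒x≡y x w∈⁅x⁆)) x∈B))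

    c∉B : c ∉ B
    c∉B = off-B (Walks.end∈ H p→c)

    r∈D : r ∈ D
    r∈D = attachment∈D r∈B c∉B (edge-from-outside c∉B e)

  -- Two vertices of D' are joined through D ∩ B, where D is connected.
  connected : ConnectedIn G D'
  connected p q p∈D' q∈D' with to-core p∈D' | to-core q∈D'
  ... | r₁ , r₁∈D , r₁∈B , p→r₁ | r₂ , r₂∈D , r₂∈B , q→r₂ =
    p→r₁ ++ʷ weaken (x∈p∪q⁺ ∘ inj₂) (stay-in-block r₁∈B r₂∈B (proj₂ D-cds r₁ r₂ r₁∈D r₂∈D))
         ++ʷ reverse q→r₂

  cds : IsCDS G D'
  cds = dominating , connected

-- The exchange set D' is a CDS of G, so k = γc(G) ≤ ∣ D' ∣, while ∣ Dxy ∣ < k by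
-- criticality; comparing the parts of Dxy and D' outside B gives the claim.
lemma12 : {n : ℕ} (k : ℕ) (G : Graph n) → Critical k G → (∃[ c ] CutVertex G c) →
    (D : Subset n) → IsGammaCSet G D →
    (B : Subset n) → IsBlock G B →
    (x y : Fin n) → x ∈ B → y ∈ B → (x≢y : x ≢ y) → ¬ Adj G x y →
    (Dxy : Subset n) → IsGammaCSet (addEdge G x y x≢y) Dxy →
    ∣ Dxy ∩ B ∣ < ∣ D ∩ B ∣
lemma12 k G ((D₀ , (_ , D₀-min) , ∣D₀∣≡k) , critical) _ D (D-cds , _) B block x y x∈B y∈B x≢y x≁y
        Dxy (Dxy-cds , Dxy-min) =
  +-cancelˡ-< (∣ Dxy ∩ ∁ B ∣) (∣ Dxy ∩ B ∣) (∣ D ∩ B ∣) (begin-strict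
    ∣ Dxy ∩ ∁ B ∣ + ∣ Dxy ∩ B ∣  ≡⟨ sym (∣p∣≡∣p∖q∣+∣p∩q∣ Dxy B) ⟩
    ∣ Dxy ∣                      <⟨ γc[G+xy]<k ⟩
    k                            ≡⟨ sym ∣D₀∣≡k ⟩
    ∣ D₀ ∣                       ≤⟨ D₀-min D' cds ⟩
    ∣ D' ∣                       ≤⟨ ∣p∪q∣≤∣p∣+∣q∣ (Dxy ∩ ∁ B) (D ∩ B) ⟩
    ∣ Dxy ∩ ∁ B ∣ + ∣ D ∩ B ∣    ∎)
  where
  open ≤-Reasoning
  open Exchange block x∈B y∈B x≢y D-cds Dxy-cds using (D'; cds)

  γc[G+xy]<k : ∣ Dxy ∣ < k
  γc[G+xy]<k with critical x y x≢y x≁y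
  ... | D₁ , (D₁-cds , _) , ∣D₁∣<k = ≤-<-trans (Dxy-min D₁ D₁-cds) ∣D₁∣<k
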